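{- If $u\in\mathbb{P}^*$ then $F(u;t,x)$, $S(u;t,x)$, and $A(u;t,x)$ are all rational functions of $t$ and $x$.
   Context: $\mathbb{P}$ is the positive integers with the usual order; $\mathbb{P}^*$ is the set of finite words over $\mathbb{P}$. Generalized factor order: $u\le w$ iff there is a factor $w'$ of $w$ (consecutive letters) with $|w'|=|u|$ and $u_i\le w'_i$ for all $i$; such $w'$ is an embedding. $\mathcal{F}(u)=\{w:w\ge u\}$; $\mathcal{S}(u)$ is the set of $w\in\mathcal{F}(u)$ for which every embedding of $u$ into $w$ is a suffix of $w$; $\mathcal{A}(u)=\{w:w\not\ge u\}$. The weight of $w=w_1\cdots w_\ell$ is $t^{\ell}x^{w_1+\cdots+w_\ell}$, and $F(u;t,x),S(u;t,x),A(u;t,x)$ are the sums of weights over $\mathcal{F}(u),\mathcal{S}(u),\mathcal{A}(u)$. -}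

module Defs where

open import Data.Nat using (ℕ; zero; suc; _≤_; _<_; _∸_; _≤?_)
open import Data.Nat.Properties using (_≟_)
open import Data.Integer as ℤ using (ℤ; +_)
open import Data.List using (List; []; _∷_; map; concatMap; tails; length; filter; upTo)
open import Data.List.Relation.Unary.Any using (Any; any?)
open import Data.List.Relation.Unary.All using (All; all?)
open import Data.List.Relation.Binary.Prefix.Heterogeneous using (Prefix)
open import Data.List.Relation.Binary.Prefix.Heterogeneous.Properties using (prefix?)
open import Data.Product using (_×_; Σ; ∃; ∃-syntax)
open import Data.Sum using (_⊎_)
open import Relation.Binary.PropositionalEquality using (_≡_; _≢_)
open import Relation.Nullary using (¬_; Dec; _×-dec_; _→-dec_; ¬?)

Word : Set
Word = List ℕ

Positive : Word → Set
Positive w = All (λ a → 1 ≤ a) w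

-- A factor of w is a prefix of a suffix (tail) of w.  An embedding of u
-- into w is a tail s of w whose length-|u| prefix w' satisfies u_i ≤ w'_i
-- for all i, i.e.  Prefix _≤_ u s.  The embedding is a suffix of w iff
-- length s ≡ length u.

PrefEmb : Word → Word → Set
PrefEmb u s = Prefix _≤_ u s

_≼_ : Word → Word → Set
u ≼ w = Any (PrefEmb u) (tails w)

InF : Word → Word → Set
InF u w = u ≼ w

InS : Word → Word → Set
InS u w = (u ≼ w) × All (λ s → PrefEmb u s → length s ≡ length u) (tails w)

InA : Word → Word → Set
InA u w = ¬ (u ≼ w)

≼? : ∀ u w → Dec (u ≼ w)
≼? u w = any? (λ s → prefix? _≤?_ u s) (tails w)

InF? : ∀ u w → Dec (InF u w)
InF? = ≼?

InS? : ∀ u w → Dec (InS u w)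
InS? u w = ≼? u w ×-dec all? (λ s → prefix? _≤?_ u s →-dec (length s ≟ length u)) (tails w)

InA? : ∀ u w → Dec (InA u w)
InA? u w = ¬? (≼? u w)

-- Words in P* of length ℓ and letter-sum n (compositions of n into ℓ
-- positive parts).  These are exactly the words of weight t^ℓ x^n.

comps : ℕ → ℕ → List Word
comps zero zero = [] ∷ []
comps zero (suc n) = []
comps (suc ℓ) n = concatMap (λ a → map (suc a ∷_) (comps ℓ (n ∸ suc a))) (upTo n)

coeff : {P : Word → Set} → (∀ w → Dec (P w)) → ℕ → ℕ → ℤ
coeff P? ℓ n = + length (filter P? (comps ℓ n))

-- Formal power series in t, x with integer coefficients: ℕ → ℕ → ℤ,
-- (i , j) ↦ coefficient of t^i x^j.

Series : Set
Series = ℕ → ℕ → ℤ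

sumTo : ℕ → (ℕ → ℤ) → ℤ
sumTo zero f = f 0
sumTo (suc m) f = sumTo m f ℤ.+ f (suc m)

_⊛_ : Series → Series → Series
(f ⊛ g) ℓ n = sumTo ℓ (λ i → sumTo n (λ j → f i j ℤ.* g (ℓ ∸ i) (n ∸ j)))

IsPolynomial : Series → Set
IsPolynomial f = ∃[ d ] (∀ i j → d < i ⊎ d < j → f i j ≡ + 0)

NonZero : Series → Set
NonZero f = ∃[ i ] ∃[ j ] (f i j ≢ + 0)

-- F is a rational function of t and x: F = P / Q with P, Q polynomials,
-- Q ≠ 0 (as an identity Q·F = P in the ring of formal power series).
IsRational : Series → Set
IsRational F = ∃[ P ] ∃[ Q ] (IsPolynomial P × IsPolynomial Q × NonZero Q
                × (∀ ℓ n → (Q ⊛ F) ℓ n ≡ P ℓ n))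

Fgf Sgf Agf : Word → Series
Fgf u = coeff (InF? u)
Sgf u = coeff (InS? u)
Agf u = coeff (InA? u)

-- Read a word w from right to left.  When a letter a is prepended, a tail x ∷ v of u
-- embeds at the start of a ∷ w iff x ≤ a and v embeds at the start of w; so the flags
-- "v embeds at the start of w" and "|w| = |v|" for the tails v of u, together with
-- "u ≼ w" and "every embedding of u into w is a suffix", form the state of a finite
-- automaton, and all letters a ≥ max u act on it alike.  The generating functions G_j of
-- the words reaching state j satisfy G_i = E_i + Σ_j M_ij G_j, where
-- M_ij = t Σ_a [a takes j to i] x^a has eventually constant coefficients, so (1 - x) M_ij
-- is a polynomial.  After multiplying by 1 - x the system has polynomial coefficients and
-- pivots with constant term 1, so eliminating the unknowns one by one expresses every G_j
-- as a quotient of polynomials; F, S and A are sums of some of the G_j.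

module Submission where

open import Defs
open import Data.Product using (_×_; _,_)

open import Algebra.Bundles using (CommutativeRing)
open import Algebra.Structures using (IsCommutativeRing)
open import Level using (0ℓ)
open import Data.Nat as ℕ using (ℕ; zero; suc; _∸_; _≤_; _<_; z≤n; s≤s)
import Data.Nat.Properties as ℕ
open import Function using (_∘_)
open import Data.Integer as ℤ using (ℤ; +_)
import Data.Integer.Properties as ℤ
open import Data.Sum using (_⊎_; inj₁; inj₂)
import Data.Sum as Sum
open import Relation.Nullary using (Dec; yes; no; does)
open import Data.List using (List; []; _∷_; _++_; length; filter; map; concatMap; applyUpTo; tails)
open import Data.List.Relation.Unary.All as All using (All; _∷_; all?)
open import Data.List.Relation.Binary.Prefix.Heterogeneous.Properties using (prefix?)
open import Data.List.Extrema.Nat using (max; xs≤max)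
open import Relation.Nullary.Decidable using (dec-true; dec-false; _→-dec_)
open import Data.Bool using (Bool; true; false; if_then_else_; _∧_; _∨_; not)
open import Data.Empty using (⊥-elim)
open import Relation.Binary.PropositionalEquality as ≡ using (_≡_; _≢_)
import Relation.Binary.Reasoning.Setoid

-- Finite sums and formal power series over a commutative ring

module FiniteSum {c ℓ} (R : CommutativeRing c ℓ) where

  open CommutativeRing R
  open import Relation.Binary.Reasoning.Setoid setoid
  open import Algebra.Properties.CommutativeSemigroup +-commutativeSemigroup using (interchange)

  ∑ : ℕ → (ℕ → Carrier) → Carrier
  ∑ zero    f = 0#
  ∑ (suc n) f = ∑ n f + f n

  ∑-cong : ∀ n {f g} → (∀ i → i < n → f i ≈ g i) → ∑ n f ≈ ∑ n g
  ∑-cong zero    f≈g = refl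
  ∑-cong (suc n) f≈g = +-cong (∑-cong n (λ i i<n → f≈g i (ℕ.m<n⇒m<1+n i<n))) (f≈g n ℕ.≤-refl)

  ∑-zero : ∀ n {f} → (∀ i → i < n → f i ≈ 0#) → ∑ n f ≈ 0#
  ∑-zero zero    f≈0 = refl
  ∑-zero (suc n) f≈0 = begin
    ∑ n _ + _ ≈⟨ +-cong (∑-zero n (λ i i<n → f≈0 i (ℕ.m<n⇒m<1+n i<n))) (f≈0 n ℕ.≤-refl) ⟩
    0# + 0#   ≈⟨ +-identityˡ 0# ⟩
    0#        ∎

  ∑-one : ∀ f → ∑ 1 f ≈ f 0
  ∑-one f = +-identityˡ (f 0)

  ∑-single : ∀ {n i} f → i < n → (∀ j → j < n → j ≢ i → f j ≈ 0#) → ∑ n f ≈ f i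
  ∑-single {suc n} {i} f i<1+n others with ℕ.m<1+n⇒m<n∨m≡n i<1+n
  ... | inj₁ i<n = begin
    ∑ n f + f n  ≈⟨ +-cong (∑-single f i<n (λ j j<n → others j (ℕ.m<n⇒m<1+n j<n)))
                           (others n ℕ.≤-refl (ℕ.<⇒≢ i<n ∘ ≡.sym)) ⟩
    f i + 0#     ≈⟨ +-identityʳ (f i) ⟩
    f i          ∎
  ... | inj₂ ≡.refl = begin
    ∑ n f + f n  ≈⟨ +-congʳ (∑-zero n (λ j j<n → others j (ℕ.m<n⇒m<1+n j<n) (ℕ.<⇒≢ j<n))) ⟩
    0# + f n     ≈⟨ +-identityˡ (f n) ⟩
    f n          ∎

  𝟙 : Bool → Carrier
  𝟙 true  = 1#
  𝟙 false = 0#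

  ∑-δ : ∀ {n i} → i < n → ∀ (f : ℕ → Carrier) → ∑ n (λ j → 𝟙 (does (i ℕ.≟ j)) * f j) ≈ f i
  ∑-δ {n} {i} i<n f = begin
    ∑ n (λ j → 𝟙 (does (i ℕ.≟ j)) * f j)
      ≈⟨ ∑-single (λ j → 𝟙 (does (i ℕ.≟ j)) * f j) i<n off-diagonal ⟩
    𝟙 (does (i ℕ.≟ i)) * f i
      ≈⟨ *-congʳ (reflexive (≡.cong 𝟙 (dec-true (i ℕ.≟ i) ≡.refl))) ⟩
    1# * f i
      ≈⟨ *-identityˡ (f i) ⟩
    f i
      ∎
    where
    off-diagonal : ∀ j → j < n → j ≢ i → 𝟙 (does (i ℕ.≟ j)) * f j ≈ 0#
    off-diagonal j _ j≢i =
      trans (*-congʳ (reflexive (≡.cong 𝟙 (dec-false (i ℕ.≟ j) (j≢i ∘ ≡.sym))))) (zeroˡ (f j))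

  ∑-distrib-+ : ∀ n f g → ∑ n (λ i → f i + g i) ≈ ∑ n f + ∑ n g
  ∑-distrib-+ zero    f g = sym (+-identityˡ 0#)
  ∑-distrib-+ (suc n) f g = trans (+-congʳ (∑-distrib-+ n f g)) (interchange _ _ _ _)

  *-distribˡ-∑ : ∀ n a f → a * ∑ n f ≈ ∑ n (λ i → a * f i)
  *-distribˡ-∑ zero    a f = zeroʳ a
  *-distribˡ-∑ (suc n) a f = trans (distribˡ _ _ _) (+-congʳ (*-distribˡ-∑ n a f))

  *-distribʳ-∑ : ∀ n a f → ∑ n f * a ≈ ∑ n (λ i → f i * a)
  *-distribʳ-∑ zero    a f = zeroˡ a
  *-distribʳ-∑ (suc n) a f = trans (distribʳ _ _ _) (+-congʳ (*-distribʳ-∑ n a f))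

  ∑-comm : ∀ m n (f : ℕ → ℕ → Carrier) → ∑ m (λ i → ∑ n (f i)) ≈ ∑ n (λ j → ∑ m (λ i → f i j))
  ∑-comm zero    n f = sym (∑-zero n (λ _ _ → refl))
  ∑-comm (suc m) n f = begin
    ∑ m (λ i → ∑ n (f i)) + ∑ n (f m)                  ≈⟨ +-congʳ (∑-comm m n f) ⟩
    ∑ n (λ j → ∑ m (λ i → f i j)) + ∑ n (f m)          ≈⟨ sym (∑-distrib-+ n _ _) ⟩
    ∑ n (λ j → ∑ m (λ i → f i j) + f m j)              ∎

  ∑-suc : ∀ n f → ∑ (suc n) f ≈ f 0 + ∑ n (f ∘ suc)
  ∑-suc zero    f = +-comm 0# (f 0)
  ∑-suc (suc n) f = begin
    ∑ (suc n) f + f (suc n)               ≈⟨ +-congʳ (∑-suc n f) ⟩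
    (f 0 + ∑ n (f ∘ suc)) + f (suc n)     ≈⟨ +-assoc _ _ _ ⟩
    f 0 + (∑ n (f ∘ suc) + f (suc n))     ∎

  ∑-reverse : ∀ n f → ∑ n f ≈ ∑ n (λ i → f (n ∸ suc i))
  ∑-reverse zero    f = refl
  ∑-reverse (suc n) f = begin
    ∑ n f + f n                               ≈⟨ +-comm _ _ ⟩
    f n + ∑ n f                               ≈⟨ +-congˡ (∑-reverse n f) ⟩
    f n + ∑ n (λ i → f (n ∸ suc i))           ≈⟨ sym (∑-suc n _) ⟩
    ∑ (suc n) (λ i → f (suc n ∸ suc i))       ∎

  ∑-triangle : ∀ n (F : ℕ → ℕ → Carrier) →
    ∑ (suc n) (λ i → ∑ (suc (n ∸ i)) (F i)) ≈ ∑ (suc n) (λ k → ∑ (suc k) (λ i → F i (k ∸ i)))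
  ∑-triangle zero    F = refl
  ∑-triangle (suc n) F = begin
    ∑ (suc (suc n)) (λ i → ∑ (suc (suc n ∸ i)) (F i))
      ≈⟨ ∑-suc (suc n) _ ⟩
    ∑ (suc (suc n)) (F 0) + ∑ (suc n) (λ i → ∑ (suc (n ∸ i)) (F (suc i)))
      ≈⟨ +-cong (∑-suc (suc n) (F 0)) (∑-triangle n (F ∘ suc)) ⟩
    (F 0 0 + ∑ (suc n) (F 0 ∘ suc)) + ∑ (suc n) (λ k → ∑ (suc k) (λ i → F (suc i) (k ∸ i)))
      ≈⟨ +-assoc _ _ _ ⟩
    F 0 0 + (∑ (suc n) (F 0 ∘ suc) + ∑ (suc n) (λ k → ∑ (suc k) (λ i → F (suc i) (k ∸ i))))
      ≈⟨ +-congˡ (sym (∑-distrib-+ (suc n) _ _)) ⟩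
    F 0 0 + ∑ (suc n) (λ k → F 0 (suc k) + ∑ (suc k) (λ i → F (suc i) (k ∸ i)))
      ≈⟨ +-congˡ (∑-cong (suc n) (λ k _ → sym (∑-suc (suc k) (λ i → F i (suc k ∸ i))))) ⟩
    F 0 0 + ∑ (suc n) (λ k → ∑ (suc (suc k)) (λ i → F i (suc k ∸ i)))
      ≈⟨ +-congʳ (sym (∑-one (λ i → F i (0 ∸ i)))) ⟩
    ∑ 1 (λ i → F i (0 ∸ i)) + ∑ (suc n) (λ k → ∑ (suc (suc k)) (λ i → F i (suc k ∸ i)))
      ≈⟨ sym (∑-suc (suc n) _) ⟩
    ∑ (suc (suc n)) (λ k → ∑ (suc k) (λ i → F i (k ∸ i)))
      ∎

module PowerSeries {c ℓ} (R : CommutativeRing c ℓ) where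

  open CommutativeRing R hiding (isCommutativeRing)
  open FiniteSum R
  open import Relation.Binary.Reasoning.Setoid setoid

  PS : Set c
  PS = ℕ → Carrier

  infix  4 _≈ₚ_
  infixl 6 _+ₚ_
  infixl 7 _*ₚ_

  _≈ₚ_ : PS → PS → Set ℓ
  f ≈ₚ g = ∀ n → f n ≈ g n

  _+ₚ_ : PS → PS → PS
  (f +ₚ g) n = f n + g n

  -ₚ_ : PS → PS
  (-ₚ f) n = - f n

  0ₚ : PS
  0ₚ _ = 0#

  1ₚ : PS
  1ₚ zero    = 1#
  1ₚ (suc _) = 0#

  _*ₚ_ : PS → PS → PS
  (f *ₚ g) n = ∑ (suc n) (λ i → f i * g (n ∸ i))

  *ₚ-cong : ∀ {f f′ g g′} → f ≈ₚ f′ → g ≈ₚ g′ → f *ₚ g ≈ₚ f′ *ₚ g′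
  *ₚ-cong f≈f′ g≈g′ n = ∑-cong (suc n) (λ i _ → *-cong (f≈f′ i) (g≈g′ (n ∸ i)))

  *ₚ-comm : ∀ f g → f *ₚ g ≈ₚ g *ₚ f
  *ₚ-comm f g n = begin
    ∑ (suc n) (λ i → f i * g (n ∸ i))                 ≈⟨ ∑-reverse (suc n) _ ⟩
    ∑ (suc n) (λ i → f (n ∸ i) * g (n ∸ (n ∸ i)))     ≈⟨ ∑-cong (suc n) swap ⟩
    ∑ (suc n) (λ i → g i * f (n ∸ i))                 ∎
    where
    swap : ∀ i → i < suc n → f (n ∸ i) * g (n ∸ (n ∸ i)) ≈ g i * f (n ∸ i)
    swap i i<1+n = trans (*-comm _ _)
      (*-congʳ (reflexive (≡.cong g (ℕ.m∸[m∸n]≡n (ℕ.s≤s⁻¹ i<1+n)))))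

  *ₚ-assoc : ∀ f g h → (f *ₚ g) *ₚ h ≈ₚ f *ₚ (g *ₚ h)
  *ₚ-assoc f g h n = begin
    ∑ (suc n) (λ k → ∑ (suc k) (λ i → f i * g (k ∸ i)) * h (n ∸ k))
      ≈⟨ ∑-cong (suc n) (λ k _ → *-distribʳ-∑ (suc k) _ _) ⟩
    ∑ (suc n) (λ k → ∑ (suc k) (λ i → (f i * g (k ∸ i)) * h (n ∸ k)))
      ≈⟨ ∑-cong (suc n) (λ k k≤n → ∑-cong (suc k) (λ i i≤k →
           trans (*-assoc _ _ _) (*-congˡ (*-congˡ (reflexive (≡.cong h
             (split (ℕ.s≤s⁻¹ i≤k)))))))) ⟩
    ∑ (suc n) (λ k → ∑ (suc k) (λ i → f i * (g (k ∸ i) * h (n ∸ i ∸ (k ∸ i)))))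
      ≈⟨ sym (∑-triangle n (λ i j → f i * (g j * h (n ∸ i ∸ j)))) ⟩
    ∑ (suc n) (λ i → ∑ (suc (n ∸ i)) (λ j → f i * (g j * h (n ∸ i ∸ j))))
      ≈⟨ ∑-cong (suc n) (λ i _ → sym (*-distribˡ-∑ (suc (n ∸ i)) _ _)) ⟩
    ∑ (suc n) (λ i → f i * ∑ (suc (n ∸ i)) (λ j → g j * h (n ∸ i ∸ j)))
      ∎
    where
    split : ∀ {i k} → i ≤ k → n ∸ k ≡ n ∸ i ∸ (k ∸ i)
    split {i} {k} i≤k = ≡.trans (≡.cong (n ∸_) (≡.sym (ℕ.m+[n∸m]≡n i≤k)))
                                (≡.sym (ℕ.∸-+-assoc n i (k ∸ i)))

  *ₚ-identityˡ : ∀ f → 1ₚ *ₚ f ≈ₚ f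
  *ₚ-identityˡ f n = begin
    ∑ (suc n) (λ i → 1ₚ i * f (n ∸ i))          ≈⟨ ∑-suc n _ ⟩
    1# * f n + ∑ n (λ i → 0# * f (n ∸ suc i))    ≈⟨ +-cong (*-identityˡ (f n)) (∑-zero n (λ i _ → zeroˡ _)) ⟩
    f n + 0#                                   ≈⟨ +-identityʳ (f n) ⟩
    f n                                        ∎

  *ₚ-identityʳ : ∀ f → f *ₚ 1ₚ ≈ₚ f
  *ₚ-identityʳ f n = trans (*ₚ-comm f 1ₚ n) (*ₚ-identityˡ f n)

  *ₚ-distribˡ-+ₚ : ∀ f g h → f *ₚ (g +ₚ h) ≈ₚ f *ₚ g +ₚ f *ₚ h
  *ₚ-distribˡ-+ₚ f g h n = trans (∑-cong (suc n) (λ i _ → distribˡ _ _ _)) (∑-distrib-+ (suc n) _ _)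

  *ₚ-distribʳ-+ₚ : ∀ f g h → (g +ₚ h) *ₚ f ≈ₚ g *ₚ f +ₚ h *ₚ f
  *ₚ-distribʳ-+ₚ f g h n = trans (∑-cong (suc n) (λ i _ → distribʳ _ _ _)) (∑-distrib-+ (suc n) _ _)

  isCommutativeRing : IsCommutativeRing _≈ₚ_ _+ₚ_ _*ₚ_ -ₚ_ 0ₚ 1ₚ
  isCommutativeRing = record
    { isRing = record
      { +-isAbelianGroup = record
        { isGroup = record
          { isMonoid = record
            { isSemigroup = record
              { isMagma = record
                { isEquivalence = record
                  { refl  = λ _ → refl
                  ; sym   = λ f≈g n → sym (f≈g n)
                  ; trans = λ f≈g g≈h n → trans (f≈g n) (g≈h n)
                  }
                ; ∙-cong = λ f≈f′ g≈g′ n → +-cong (f≈f′ n) (g≈g′ n)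
                }
              ; assoc = λ f g h n → +-assoc (f n) (g n) (h n)
              }
            ; identity = (λ f n → +-identityˡ (f n)) , (λ f n → +-identityʳ (f n))
            }
          ; inverse = (λ f n → -‿inverseˡ (f n)) , (λ f n → -‿inverseʳ (f n))
          ; ⁻¹-cong = λ f≈g n → -‿cong (f≈g n)
          }
        ; comm = λ f g n → +-comm (f n) (g n)
        }
      ; *-cong     = *ₚ-cong
      ; *-assoc    = *ₚ-assoc
      ; *-identity = *ₚ-identityˡ , *ₚ-identityʳ
      ; distrib    = (λ f g h → *ₚ-distribˡ-+ₚ f g h) , (λ f g h → *ₚ-distribʳ-+ₚ f g h)
      }
    ; *-comm = *ₚ-comm
    }

  commutativeRing : CommutativeRing c ℓ
  commutativeRing = record { isCommutativeRing = isCommutativeRing }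

  ∑-pointwise : ∀ m (h : ℕ → PS) n → FiniteSum.∑ commutativeRing m h n ≈ ∑ m (λ i → h i n)
  ∑-pointwise zero    h n = refl
  ∑-pointwise (suc m) h n = +-congʳ (∑-pointwise m h n)

ℤ⟦x⟧ : CommutativeRing _ _
ℤ⟦x⟧ = PowerSeries.commutativeRing ℤ.+-*-commutativeRing

ℤ⟦x⟧⟦t⟧ : CommutativeRing _ _
ℤ⟦x⟧⟦t⟧ = PowerSeries.commutativeRing ℤ⟦x⟧

module ℤΣ = FiniteSum ℤ.+-*-commutativeRing

infix  4 _≈_
infixl 6 _+_
infixl 7 _*_
infix  8 -_

-- Opaque, so that unification never unfolds a product into its nested coefficient sums.
opaque
  _≈_ : Series → Series → Set
  _≈_ = CommutativeRing._≈_ ℤ⟦x⟧⟦t⟧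

  _+_ _*_ : Series → Series → Series
  _+_ = CommutativeRing._+_ ℤ⟦x⟧⟦t⟧
  _*_ = CommutativeRing._*_ ℤ⟦x⟧⟦t⟧

  -_ : Series → Series
  -_ = CommutativeRing.-_ ℤ⟦x⟧⟦t⟧

  0# 1# : Series
  0# = CommutativeRing.0# ℤ⟦x⟧⟦t⟧
  1# = CommutativeRing.1# ℤ⟦x⟧⟦t⟧

opaque
  unfolding _≈_ _+_ _*_ -_ 0# 1#

  isCommutativeRing : IsCommutativeRing _≈_ _+_ _*_ -_ 0# 1#
  isCommutativeRing = CommutativeRing.isCommutativeRing ℤ⟦x⟧⟦t⟧

  ≈⇒coeff : ∀ {f g} → f ≈ g → ∀ ℓ n → f ℓ n ≡ g ℓ n
  ≈⇒coeff f≈g = f≈g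

  coeff⇒≈ : ∀ {f g} → (∀ ℓ n → f ℓ n ≡ g ℓ n) → f ≈ g
  coeff⇒≈ f≡g = f≡g

  +-coeff : ∀ f g ℓ n → (f + g) ℓ n ≡ f ℓ n ℤ.+ g ℓ n
  +-coeff f g ℓ n = ≡.refl

  neg-coeff : ∀ f ℓ n → (- f) ℓ n ≡ ℤ.- f ℓ n
  neg-coeff f ℓ n = ≡.refl

  0#-coeff : ∀ ℓ n → 0# ℓ n ≡ + 0
  0#-coeff ℓ n = ≡.refl

  1#-00 : 1# 0 0 ≡ + 1
  1#-00 = ≡.refl

  poly-1# : IsPolynomial 1#
  poly-1# = 0 , vanishes
    where
    vanishes : ∀ i j → 0 < i ⊎ 0 < j → 1# i j ≡ + 0
    vanishes (suc i) j       _        = ≡.refl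
    vanishes zero    (suc j) _        = ≡.refl
    vanishes zero    zero    (inj₁ ())
    vanishes zero    zero    (inj₂ ())

  *-coeff : ∀ f g ℓ n →
    (f * g) ℓ n ≡ ℤΣ.∑ (suc ℓ) (λ i → ℤΣ.∑ (suc n) (λ j → f i j ℤ.* g (ℓ ∸ i) (n ∸ j)))
  *-coeff f g ℓ n = PowerSeries.∑-pointwise ℤ.+-*-commutativeRing (suc ℓ)
    (λ i → CommutativeRing._*_ ℤ⟦x⟧ (f i) (g (ℓ ∸ i))) n

ℤ⟦t,x⟧ : CommutativeRing 0ℓ 0ℓ
ℤ⟦t,x⟧ = record { isCommutativeRing = isCommutativeRing }

open CommutativeRing ℤ⟦t,x⟧
  hiding (Carrier; _≈_; _+_; _*_; -_; 0#; 1#; isCommutativeRing)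
module ≈-Reasoning = Relation.Binary.Reasoning.Setoid setoid
open FiniteSum ℤ⟦t,x⟧

∑-coeff : ∀ m (h : ℕ → Series) ℓ n → ∑ m h ℓ n ≡ ℤΣ.∑ m (λ i → h i ℓ n)
∑-coeff zero    h ℓ n = 0#-coeff ℓ n
∑-coeff (suc m) h ℓ n = ≡.trans (+-coeff (∑ m h) (h m) ℓ n) (≡.cong (ℤ._+ h m ℓ n) (∑-coeff m h ℓ n))

sumTo≡∑ : ∀ m f → sumTo m f ≡ ℤΣ.∑ (suc m) f
sumTo≡∑ zero    f = ≡.sym (ℤ.+-identityˡ (f 0))
sumTo≡∑ (suc m) f = ≡.cong (ℤ._+ f (suc m)) (sumTo≡∑ m f)

⊛≡* : ∀ f g ℓ n → (f ⊛ g) ℓ n ≡ (f * g) ℓ n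
⊛≡* f g ℓ n = begin
  sumTo ℓ (λ i → sumTo n (λ j → f i j ℤ.* g (ℓ ∸ i) (n ∸ j)))
    ≡⟨ sumTo≡∑ ℓ _ ⟩
  ℤΣ.∑ (suc ℓ) (λ i → sumTo n (λ j → f i j ℤ.* g (ℓ ∸ i) (n ∸ j)))
    ≡⟨ ℤΣ.∑-cong (suc ℓ) (λ i _ → sumTo≡∑ n _) ⟩
  ℤΣ.∑ (suc ℓ) (λ i → ℤΣ.∑ (suc n) (λ j → f i j ℤ.* g (ℓ ∸ i) (n ∸ j)))
    ≡⟨ ≡.sym (*-coeff f g ℓ n) ⟩
  (f * g) ℓ n ∎
  where open ≡.≡-Reasoning

poly-resp-≈ : ∀ {f g} → f ≈ g → IsPolynomial f → IsPolynomial g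
poly-resp-≈ f≈g (d , f-vanishes) = d , λ i j out → ≡.trans (≡.sym (≈⇒coeff f≈g i j)) (f-vanishes i j out)

poly-0# : IsPolynomial 0#
poly-0# = 0 , λ i j _ → 0#-coeff i j

poly-neg : ∀ {f} → IsPolynomial f → IsPolynomial (- f)
poly-neg {f} (d , f-vanishes) =
  d , λ i j out → ≡.trans (neg-coeff f i j) (≡.cong ℤ.-_ (f-vanishes i j out))

poly-+ : ∀ {f g} → IsPolynomial f → IsPolynomial g → IsPolynomial (f + g)
poly-+ {f} {g} (d₁ , f-vanishes) (d₂ , g-vanishes) = d₁ ℕ.⊔ d₂ , λ i j out →
  ≡.trans (+-coeff f g i j) (≡.cong₂ ℤ._+_ (f-vanishes i j (shrink (ℕ.m≤m⊔n d₁ d₂) out))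
                                           (g-vanishes i j (shrink (ℕ.m≤n⊔m d₁ d₂) out)))
  where
  shrink : ∀ {d d′ i j} → d ≤ d′ → d′ < i ⊎ d′ < j → d < i ⊎ d < j
  shrink d≤d′ = Sum.map (ℕ.≤-<-trans d≤d′) (ℕ.≤-<-trans d≤d′)

split-bound : ∀ d₁ d₂ {i} i′ → d₁ ℕ.+ d₂ < i → d₁ < i′ ⊎ d₂ < i ∸ i′
split-bound d₁ d₂ i′ d₁+d₂<i with d₁ ℕ.<? i′
... | yes d₁<i′ = inj₁ d₁<i′
... | no  d₁≮i′ = inj₂ (ℕ.m+n≤o⇒m≤o∸n (suc d₂) (begin
  suc d₂ ℕ.+ i′   ≤⟨ ℕ.+-monoʳ-≤ (suc d₂) (ℕ.≮⇒≥ d₁≮i′) ⟩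
  suc d₂ ℕ.+ d₁   ≡⟨ ≡.cong suc (ℕ.+-comm d₂ d₁) ⟩
  suc (d₁ ℕ.+ d₂) ≤⟨ d₁+d₂<i ⟩
  _               ∎))
  where open ℕ.≤-Reasoning

poly-* : ∀ {f g} → IsPolynomial f → IsPolynomial g → IsPolynomial (f * g)
poly-* {f} {g} (d₁ , f-vanishes) (d₂ , g-vanishes) = d₁ ℕ.+ d₂ , vanishes
  where
  term-vanishes : ∀ {i j i′ j′} → (d₁ < i′ ⊎ d₁ < j′) ⊎ (d₂ < i ∸ i′ ⊎ d₂ < j ∸ j′) →
                  f i′ j′ ℤ.* g (i ∸ i′) (j ∸ j′) ≡ + 0
  term-vanishes {i} {j} {i′} {j′} (inj₁ out) = ≡.cong (ℤ._* g (i ∸ i′) (j ∸ j′)) (f-vanishes i′ j′ out)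
  term-vanishes {i} {j} {i′} {j′} (inj₂ out) =
    ≡.trans (≡.cong (f i′ j′ ℤ.*_) (g-vanishes (i ∸ i′) (j ∸ j′) out)) (ℤ.*-zeroʳ (f i′ j′))

  vanishes : ∀ i j → d₁ ℕ.+ d₂ < i ⊎ d₁ ℕ.+ d₂ < j → (f * g) i j ≡ + 0
  vanishes i j out = ≡.trans (*-coeff f g i j)
    (ℤΣ.∑-zero (suc i) (λ i′ _ → ℤΣ.∑-zero (suc j) (λ j′ _ → term-vanishes (by-cases i′ j′ out))))
    where
    by-cases : ∀ i′ j′ → d₁ ℕ.+ d₂ < i ⊎ d₁ ℕ.+ d₂ < j →
               (d₁ < i′ ⊎ d₁ < j′) ⊎ (d₂ < i ∸ i′ ⊎ d₂ < j ∸ j′)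
    by-cases i′ j′ (inj₁ <i) = Sum.map inj₁ inj₁ (split-bound d₁ d₂ i′ <i)
    by-cases i′ j′ (inj₂ <j) = Sum.map inj₂ inj₂ (split-bound d₁ d₂ j′ <j)

univariate : (ℕ → ℤ) → Series
univariate h zero    = h
univariate h (suc _) = λ _ → + 0

t·_ : (ℕ → ℤ) → Series
(t· h) (suc zero)    = h
(t· h) zero          = λ _ → + 0
(t· h) (suc (suc _)) = λ _ → + 0

univariate-*-coeff : ∀ h g ℓ n → (univariate h * g) ℓ n ≡ ℤΣ.∑ (suc n) (λ j → h j ℤ.* g ℓ (n ∸ j))
univariate-*-coeff h g ℓ n = ≡.trans (*-coeff (univariate h) g ℓ n) (ℤΣ.∑-single term (s≤s z≤n) others)
  where
  term : ℕ → ℤ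
  term i = ℤΣ.∑ (suc n) (λ j → univariate h i j ℤ.* g (ℓ ∸ i) (n ∸ j))
  others : ∀ i → i < suc ℓ → i ≢ 0 → term i ≡ + 0
  others zero    _ 0≢0 = ⊥-elim (0≢0 ≡.refl)
  others (suc i) _ _   = ℤΣ.∑-zero (suc n) (λ _ _ → ≡.refl)

t·-*-coeff-zero : ∀ h g n → (t· h * g) 0 n ≡ + 0
t·-*-coeff-zero h g n = ≡.trans (*-coeff (t· h) g 0 n)
  (≡.trans (ℤΣ.∑-one (λ i → ℤΣ.∑ (suc n) (λ j → (t· h) i j ℤ.* g (0 ∸ i) (n ∸ j))))
           (ℤΣ.∑-zero (suc n) (λ _ _ → ≡.refl)))

t·-*-coeff-suc : ∀ h g ℓ n → (t· h * g) (suc ℓ) n ≡ ℤΣ.∑ (suc n) (λ j → h j ℤ.* g ℓ (n ∸ j))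
t·-*-coeff-suc h g ℓ n = ≡.trans (*-coeff (t· h) g (suc ℓ) n) (ℤΣ.∑-single term (s≤s (s≤s z≤n)) others)
  where
  term : ℕ → ℤ
  term i = ℤΣ.∑ (suc n) (λ j → (t· h) i j ℤ.* g (suc ℓ ∸ i) (n ∸ j))
  others : ∀ i → i < suc (suc ℓ) → i ≢ 1 → term i ≡ + 0
  others zero          _ _   = ℤΣ.∑-zero (suc n) (λ _ _ → ≡.refl)
  others (suc (suc i)) _ _   = ℤΣ.∑-zero (suc n) (λ _ _ → ≡.refl)
  others (suc zero)    _ 1≢1 = ⊥-elim (1≢1 ≡.refl)

x¹ : ℕ → ℤ
x¹ (suc zero)    = + 1
x¹ zero          = + 0
x¹ (suc (suc _)) = + 0

X : Series
X = univariate x¹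

X*-coeff-zero : ∀ f ℓ → (X * f) ℓ 0 ≡ + 0
X*-coeff-zero f ℓ = ≡.trans (univariate-*-coeff x¹ f ℓ 0) (ℤΣ.∑-one (λ j → x¹ j ℤ.* f ℓ (0 ∸ j)))

X*-coeff-suc : ∀ f ℓ n → (X * f) ℓ (suc n) ≡ f ℓ n
X*-coeff-suc f ℓ n = begin
  (X * f) ℓ (suc n)                                  ≡⟨ univariate-*-coeff x¹ f ℓ (suc n) ⟩
  ℤΣ.∑ (suc (suc n)) (λ j → x¹ j ℤ.* f ℓ (suc n ∸ j))  ≡⟨ ℤΣ.∑-single _ (s≤s (s≤s z≤n)) others ⟩
  + 1 ℤ.* f ℓ n                                      ≡⟨ ℤ.*-identityˡ (f ℓ n) ⟩
  f ℓ n                                              ∎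
  where
  open ≡.≡-Reasoning
  others : ∀ j → j < suc (suc n) → j ≢ 1 → x¹ j ℤ.* f ℓ (suc n ∸ j) ≡ + 0
  others zero          _ _   = ≡.refl
  others (suc (suc j)) _ _   = ≡.refl
  others (suc zero)    _ 1≢1 = ⊥-elim (1≢1 ≡.refl)

poly-X : IsPolynomial X
poly-X = 1 , vanishes
  where
  vanishes : ∀ i j → 1 < i ⊎ 1 < j → X i j ≡ + 0
  vanishes (suc i) j                   _ = ≡.refl
  vanishes zero    zero                _ = ≡.refl
  vanishes zero    (suc (suc j))       _ = ≡.refl
  vanishes zero    (suc zero) (inj₁ ())
  vanishes zero    (suc zero) (inj₂ (s≤s ()))

1-x : Series
1-x = 1# - X

poly-1-x : IsPolynomial 1-x
poly-1-x = poly-+ poly-1# (poly-neg poly-X)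

1-x-00 : 1-x 0 0 ≡ + 1
1-x-00 rewrite +-coeff 1# (- X) 0 0 | neg-coeff X 0 0 | 1#-00 = ≡.refl

-- The coefficients of (1 - x) f are the differences of consecutive coefficients of f.
eventually-constant⇒poly-1-x* : ∀ d {f} → (∀ ℓ n → d < ℓ → f ℓ n ≡ + 0) →
  (∀ ℓ n → d < n → f ℓ (suc n) ≡ f ℓ n) → IsPolynomial (1-x * f)
eventually-constant⇒poly-1-x* d {f} high-t stable = poly-resp-≈ (sym 1-x*f≈f-Xf) (suc d , vanishes)
  where
  open import Algebra.Properties.Ring ring using ([y-z]x≈yx-zx)
  1-x*f≈f-Xf : 1-x * f ≈ f - X * f
  1-x*f≈f-Xf = trans ([y-z]x≈yx-zx f 1# X) (+-congʳ (*-identityˡ f))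

  difference : ∀ ℓ n → (f - X * f) ℓ n ≡ f ℓ n ℤ.- (X * f) ℓ n
  difference ℓ n = ≡.trans (+-coeff f (- (X * f)) ℓ n) (≡.cong (ℤ._+_ (f ℓ n)) (neg-coeff (X * f) ℓ n))

  vanishes : ∀ ℓ n → suc d < ℓ ⊎ suc d < n → (f - X * f) ℓ n ≡ + 0
  vanishes ℓ zero (inj₁ 1+d<ℓ)
    rewrite difference ℓ 0 | X*-coeff-zero f ℓ | high-t ℓ 0 (ℕ.<⇒≤ 1+d<ℓ) = ≡.refl
  vanishes ℓ (suc n) out rewrite difference ℓ (suc n) | X*-coeff-suc f ℓ n = case out
    where
    case : suc d < ℓ ⊎ suc d < suc n → f ℓ (suc n) ℤ.- f ℓ n ≡ + 0
    case (inj₁ 1+d<ℓ) rewrite high-t ℓ (suc n) (ℕ.<⇒≤ 1+d<ℓ) | high-t ℓ n (ℕ.<⇒≤ 1+d<ℓ) = ≡.refl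
    case (inj₂ 1+d<1+n) rewrite stable ℓ n (ℕ.s<s⁻¹ 1+d<1+n) = ℤ.+-inverseʳ (f ℓ n)

-- Rational series and linear systems

constant-term-* : ∀ f g → (f * g) 0 0 ≡ f 0 0 ℤ.* g 0 0
constant-term-* f g = begin
  (f * g) 0 0
    ≡⟨ *-coeff f g 0 0 ⟩
  ℤΣ.∑ 1 (λ i → ℤΣ.∑ 1 (λ j → f i j ℤ.* g (0 ∸ i) (0 ∸ j)))
    ≡⟨ ℤΣ.∑-one (λ i → ℤΣ.∑ 1 (λ j → f i j ℤ.* g (0 ∸ i) (0 ∸ j))) ⟩
  ℤΣ.∑ 1 (λ j → f 0 j ℤ.* g 0 (0 ∸ j))
    ≡⟨ ℤΣ.∑-one (λ j → f 0 j ℤ.* g 0 (0 ∸ j)) ⟩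
  f 0 0 ℤ.* g 0 0
    ∎
  where open ≡.≡-Reasoning

-- Normalising the constant term of the denominator to 1 keeps it nonzero under products.
record Fraction (G : Series) : Set where
  field
    num den  : Series
    num-poly : IsPolynomial num
    den-poly : IsPolynomial den
    den-00   : den 0 0 ≡ + 1
    den*≈num : den * G ≈ num

open Fraction

fraction⇒isRational : ∀ {G} → Fraction G → IsRational G
fraction⇒isRational {G} F = num F , den F , num-poly F , den-poly F , (0 , 0 , den-00≢0) ,
  λ ℓ n → ≡.trans (⊛≡* (den F) G ℓ n) (≈⇒coeff (den*≈num F) ℓ n)
  where
  den-00≢0 : den F 0 0 ≢ + 0
  den-00≢0 den-00≡0 with ≡.trans (≡.sym (den-00 F)) den-00≡0
  ... | ()

fraction-resp-≈ : ∀ {G G′} → G ≈ G′ → Fraction G → Fraction G′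
fraction-resp-≈ G≈G′ F = record
  { num = num F ; den = den F ; num-poly = num-poly F ; den-poly = den-poly F ; den-00 = den-00 F
  ; den*≈num = trans (*-congˡ (sym G≈G′)) (den*≈num F) }

fraction-poly : ∀ {p} → IsPolynomial p → Fraction p
fraction-poly {p} p-poly = record
  { num = p ; den = 1# ; num-poly = p-poly ; den-poly = poly-1# ; den-00 = 1#-00
  ; den*≈num = *-identityˡ p }

fraction-+ : ∀ {G H} → Fraction G → Fraction H → Fraction (G + H)
fraction-+ {G} {H} F₁ F₂ = record
  { num      = Q₂ * P₁ + Q₁ * P₂
  ; den      = Q₁ * Q₂
  ; num-poly = poly-+ (poly-* (den-poly F₂) (num-poly F₁)) (poly-* (den-poly F₁) (num-poly F₂))
  ; den-poly = poly-* (den-poly F₁) (den-poly F₂)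
  ; den-00   = ≡.trans (constant-term-* Q₁ Q₂) (≡.cong₂ ℤ._*_ (den-00 F₁) (den-00 F₂))
  ; den*≈num = begin
      (Q₁ * Q₂) * (G + H)
        ≈⟨ distribˡ _ _ _ ⟩
      (Q₁ * Q₂) * G + (Q₁ * Q₂) * H
        ≈⟨ +-cong (trans (*-congʳ (*-comm Q₁ Q₂)) (*-assoc _ _ _)) (*-assoc _ _ _) ⟩
      Q₂ * (Q₁ * G) + Q₁ * (Q₂ * H)
        ≈⟨ +-cong (*-congˡ (den*≈num F₁)) (*-congˡ (den*≈num F₂)) ⟩
      Q₂ * P₁ + Q₁ * P₂
        ∎
  }
  where
  open ≈-Reasoning
  P₁ Q₁ P₂ Q₂ : Series
  P₁ = num F₁
  Q₁ = den F₁
  P₂ = num F₂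
  Q₂ = den F₂

fraction-0# : Fraction 0#
fraction-0# = fraction-poly poly-0#

fraction-∑ : ∀ n G → (∀ j → j < n → Fraction (G j)) → Fraction (∑ n G)
fraction-∑ zero    G F = fraction-0#
fraction-∑ (suc n) G F = fraction-+ (fraction-∑ n G (λ j j<n → F j (ℕ.m<n⇒m<1+n j<n))) (F n ℕ.≤-refl)

fraction-poly-* : ∀ {p G} → IsPolynomial p → Fraction G → Fraction (p * G)
fraction-poly-* {p} {G} p-poly F = record
  { num      = p * num F
  ; den      = den F
  ; den-poly = den-poly F
  ; den-00   = den-00 F
  ; num-poly = poly-* p-poly (num-poly F)
  ; den*≈num = begin
      den F * (p * G)  ≈⟨ sym (*-assoc _ _ _) ⟩
      (den F * p) * G  ≈⟨ *-congʳ (*-comm _ _) ⟩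
      (p * den F) * G  ≈⟨ *-assoc _ _ _ ⟩
      p * (den F * G)  ≈⟨ *-congˡ (den*≈num F) ⟩
      p * num F        ∎
  }
  where open ≈-Reasoning

fraction-cancel : ∀ {D G H} → IsPolynomial D → D 0 0 ≡ + 1 → D * G ≈ H → Fraction H → Fraction G
fraction-cancel {D} D-poly D-00 DG≈H F = record
  { num      = num F
  ; num-poly = num-poly F
  ; den      = den F * D
  ; den-poly = poly-* (den-poly F) D-poly
  ; den-00   = ≡.trans (constant-term-* (den F) D) (≡.cong₂ ℤ._*_ (den-00 F) D-00)
  ; den*≈num = trans (*-assoc _ _ _) (trans (*-congˡ DG≈H) (den*≈num F))
  }

-- Q G_i = a_i + Σ_{j<N} M_ij G_j.  Solving for the last unknown divides by the pivot
-- Q - M_NN, whose constant term stays 1 because every M_ij(0,0) = 0.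
record PolynomialSystem (N : ℕ) (G : ℕ → Series) : Set where
  field
    scale       : Series
    const       : ℕ → Series
    matrix      : ℕ → ℕ → Series
    scale-poly  : IsPolynomial scale
    scale-00    : scale 0 0 ≡ + 1
    const-poly  : ∀ i → IsPolynomial (const i)
    matrix-poly : ∀ i j → IsPolynomial (matrix i j)
    matrix-00   : ∀ i j → matrix i j 0 0 ≡ + 0
    equation    : ∀ i → i < N → scale * G i ≈ const i + ∑ N (λ j → matrix i j * G j)

module Elimination {N G} (sys : PolynomialSystem (suc N) G) where

  open PolynomialSystem sys

  rest : ℕ → Series
  rest i = ∑ N (λ j → matrix i j * G j)

  pivot : Series
  pivot = scale - matrix N N

  pivot-poly : IsPolynomial pivot
  pivot-poly = poly-+ scale-poly (poly-neg (matrix-poly N N))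

  pivot-00 : pivot 0 0 ≡ + 1
  pivot-00 rewrite +-coeff scale (- matrix N N) 0 0 | neg-coeff (matrix N N) 0 0
                 | scale-00 | matrix-00 N N = ≡.refl

  pivot-equation : pivot * G N ≈ const N + rest N
  pivot-equation = begin
    (scale - matrix N N) * G N                                    ≈⟨ [y-z]x≈yx-zx _ _ _ ⟩
    scale * G N - matrix N N * G N                                ≈⟨ +-congʳ (equation N ℕ.≤-refl) ⟩
    (const N + (rest N + matrix N N * G N)) - matrix N N * G N    ≈⟨ +-congʳ (sym (+-assoc _ _ _)) ⟩
    ((const N + rest N) + matrix N N * G N) - matrix N N * G N    ≈⟨ +-assoc _ _ _ ⟩
    (const N + rest N) + (matrix N N * G N - matrix N N * G N)    ≈⟨ +-congˡ (-‿inverseʳ _) ⟩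
    (const N + rest N) + 0#                                       ≈⟨ +-identityʳ _ ⟩
    const N + rest N                                              ∎
    where open ≈-Reasoning
          open import Algebra.Properties.Ring ring using ([y-z]x≈yx-zx)

  const′ : ℕ → Series
  const′ i = pivot * const i + matrix i N * const N

  matrix′ : ℕ → ℕ → Series
  matrix′ i j = pivot * matrix i j + matrix i N * matrix N j

  rest′ : ∀ i → ∑ N (λ j → matrix′ i j * G j) ≈ pivot * rest i + matrix i N * rest N
  rest′ i = begin
    ∑ N (λ j → (pivot * matrix i j + matrix i N * matrix N j) * G j)
      ≈⟨ ∑-cong N (λ j _ → trans (distribʳ _ _ _) (+-cong (*-assoc _ _ _) (*-assoc _ _ _))) ⟩
    ∑ N (λ j → pivot * (matrix i j * G j) + matrix i N * (matrix N j * G j))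
      ≈⟨ ∑-distrib-+ N _ _ ⟩
    ∑ N (λ j → pivot * (matrix i j * G j)) + ∑ N (λ j → matrix i N * (matrix N j * G j))
      ≈⟨ sym (+-cong (*-distribˡ-∑ N _ _) (*-distribˡ-∑ N _ _)) ⟩
    pivot * rest i + matrix i N * rest N
      ∎
    where open ≈-Reasoning

  reduced-equation : ∀ i → i < N → (pivot * scale) * G i ≈ const′ i + ∑ N (λ j → matrix′ i j * G j)
  reduced-equation i i<N = begin
    (pivot * scale) * G i
      ≈⟨ *-assoc _ _ _ ⟩
    pivot * (scale * G i)
      ≈⟨ *-congˡ (equation i (ℕ.m<n⇒m<1+n i<N)) ⟩
    pivot * (const i + (rest i + matrix i N * G N))
      ≈⟨ trans (distribˡ _ _ _) (+-congˡ (distribˡ _ _ _)) ⟩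
    pivot * const i + (pivot * rest i + pivot * (matrix i N * G N))
      ≈⟨ +-congˡ (+-congˡ substituted) ⟩
    pivot * const i + (pivot * rest i + (matrix i N * const N + matrix i N * rest N))
      ≈⟨ sym (+-assoc _ _ _) ⟩
    (pivot * const i + pivot * rest i) + (matrix i N * const N + matrix i N * rest N)
      ≈⟨ interchange _ _ _ _ ⟩
    const′ i + (pivot * rest i + matrix i N * rest N)
      ≈⟨ +-congˡ (sym (rest′ i)) ⟩
    const′ i + ∑ N (λ j → matrix′ i j * G j)
      ∎
    where
    open ≈-Reasoning
    open import Algebra.Properties.CommutativeSemigroup +-commutativeSemigroup using (interchange)
    substituted : pivot * (matrix i N * G N) ≈ matrix i N * const N + matrix i N * rest N
    substituted = begin
      pivot * (matrix i N * G N)  ≈⟨ x∙yz≈y∙xz _ _ _ ⟩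
      matrix i N * (pivot * G N)  ≈⟨ *-congˡ pivot-equation ⟩
      matrix i N * (const N + rest N) ≈⟨ distribˡ _ _ _ ⟩
      matrix i N * const N + matrix i N * rest N ∎
      where open import Algebra.Properties.CommutativeSemigroup *-commutativeSemigroup using (x∙yz≈y∙xz)

  reduced : PolynomialSystem N G
  reduced = record
    { scale       = pivot * scale
    ; const       = const′
    ; matrix      = matrix′
    ; scale-poly  = poly-* pivot-poly scale-poly
    ; scale-00    = ≡.trans (constant-term-* pivot scale) (≡.cong₂ ℤ._*_ pivot-00 scale-00)
    ; const-poly  = λ i → poly-+ (poly-* pivot-poly (const-poly i))
                                 (poly-* (matrix-poly i N) (const-poly N))
    ; matrix-poly = λ i j → poly-+ (poly-* pivot-poly (matrix-poly i j))
                                   (poly-* (matrix-poly i N) (matrix-poly N j))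
    ; matrix-00   = matrix′-00
    ; equation    = reduced-equation
    }
    where
    matrix′-00 : ∀ i j → matrix′ i j 0 0 ≡ + 0
    matrix′-00 i j = begin
      matrix′ i j 0 0
        ≡⟨ +-coeff (pivot * matrix i j) (matrix i N * matrix N j) 0 0 ⟩
      (pivot * matrix i j) 0 0 ℤ.+ (matrix i N * matrix N j) 0 0
        ≡⟨ ≡.cong₂ ℤ._+_ (constant-term-* pivot (matrix i j))
                         (constant-term-* (matrix i N) (matrix N j)) ⟩
      pivot 0 0 ℤ.* matrix i j 0 0 ℤ.+ matrix i N 0 0 ℤ.* matrix N j 0 0
        ≡⟨ ≡.cong₂ (λ a b → pivot 0 0 ℤ.* a ℤ.+ b ℤ.* matrix N j 0 0) (matrix-00 i j) (matrix-00 i N) ⟩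
      pivot 0 0 ℤ.* + 0 ℤ.+ + 0
        ≡⟨ ≡.cong (ℤ._+ + 0) (ℤ.*-zeroʳ (pivot 0 0)) ⟩
      + 0
        ∎
      where open ≡.≡-Reasoning

  fraction-last : (∀ j → j < N → Fraction (G j)) → Fraction (G N)
  fraction-last earlier = fraction-cancel pivot-poly pivot-00 pivot-equation
    (fraction-+ (fraction-poly (const-poly N))
                (fraction-∑ N _ (λ j j<N → fraction-poly-* (matrix-poly N j) (earlier j j<N))))

polynomialSystem⇒fraction : ∀ {N G} → PolynomialSystem N G → ∀ i → i < N → Fraction (G i)
polynomialSystem⇒fraction {suc N} sys i i<1+N with ℕ.m<1+n⇒m<n∨m≡n i<1+N
... | inj₁ i<N    = polynomialSystem⇒fraction (Elimination.reduced sys) i i<N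
... | inj₂ ≡.refl = Elimination.fraction-last sys (polynomialSystem⇒fraction (Elimination.reduced sys))

-- Counting words by the state of an automaton

count : (Word → Bool) → List Word → ℤ
count p []       = + 0
count p (w ∷ ws) = ℤΣ.𝟙 (p w) ℤ.+ count p ws

length-filter≡count : ∀ {P : Word → Set} (P? : ∀ w → Dec (P w)) ws →
  + length (filter P? ws) ≡ count (does ∘ P?) ws
length-filter≡count P? []       = ≡.refl
length-filter≡count P? (w ∷ ws) with does (P? w)
... | true  = ≡.cong (ℤ._+_ (+ 1)) (length-filter≡count P? ws)
... | false = ≡.trans (length-filter≡count P? ws) (≡.sym (ℤ.+-identityˡ _))

count-cong : ∀ {p q} → (∀ w → p w ≡ q w) → ∀ ws → count p ws ≡ count q ws
count-cong p≡q []       = ≡.refl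
count-cong p≡q (w ∷ ws) = ≡.cong₂ ℤ._+_ (≡.cong ℤΣ.𝟙 (p≡q w)) (count-cong p≡q ws)

count-++ : ∀ p xs ys → count p (xs ++ ys) ≡ count p xs ℤ.+ count p ys
count-++ p []       ys = ≡.sym (ℤ.+-identityˡ _)
count-++ p (x ∷ xs) ys = ≡.trans (≡.cong (ℤ._+_ (ℤΣ.𝟙 (p x))) (count-++ p xs ys))
                                 (≡.sym (ℤ.+-assoc (ℤΣ.𝟙 (p x)) (count p xs) (count p ys)))

count-map : ∀ p f ws → count p (map f ws) ≡ count (p ∘ f) ws
count-map p f []       = ≡.refl
count-map p f (w ∷ ws) = ≡.cong (ℤ._+_ (ℤΣ.𝟙 (p (f w)))) (count-map p f ws)

count-concatMap : ∀ p (f : ℕ → List Word) g n →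
  count p (concatMap f (applyUpTo g n)) ≡ ℤΣ.∑ n (λ a → count p (f (g a)))
count-concatMap p f g zero    = ≡.refl
count-concatMap p f g (suc n) = begin
  count p (f (g 0) ++ concatMap f (applyUpTo (g ∘ suc) n))
    ≡⟨ count-++ p (f (g 0)) _ ⟩
  count p (f (g 0)) ℤ.+ count p (concatMap f (applyUpTo (g ∘ suc) n))
    ≡⟨ ≡.cong (ℤ._+_ (count p (f (g 0)))) (count-concatMap p f (g ∘ suc) n) ⟩
  count p (f (g 0)) ℤ.+ ℤΣ.∑ n (λ a → count p (f (g (suc a))))
    ≡⟨ ≡.sym (ℤΣ.∑-suc n _) ⟩
  ℤΣ.∑ (suc n) (λ a → count p (f (g a)))
    ∎
  where open ≡.≡-Reasoning

count-comps-suc : ∀ p ℓ n →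
  count p (comps (suc ℓ) n) ≡ ℤΣ.∑ n (λ a → count (p ∘ (suc a ∷_)) (comps ℓ (n ∸ suc a)))
count-comps-suc p ℓ n = ≡.trans (count-concatMap p _ (λ a → a) n)
  (ℤΣ.∑-cong n (λ a _ → count-map p (suc a ∷_) (comps ℓ (n ∸ suc a))))

count-partition : ∀ (st : Word → ℕ) {N} → (∀ w → st w < N) → ∀ (g : ℕ → Bool) ws →
  count (g ∘ st) ws ≡ ℤΣ.∑ N (λ j → ℤΣ.𝟙 (g j) ℤ.* count (λ w → does (st w ℕ.≟ j)) ws)
count-partition st {N} st<N g [] = ≡.sym (ℤΣ.∑-zero N (λ j _ → ℤ.*-zeroʳ (ℤΣ.𝟙 (g j))))
count-partition st {N} st<N g (w ∷ ws) = begin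
  ℤΣ.𝟙 (g (st w)) ℤ.+ count (g ∘ st) ws
    ≡⟨ ≡.cong₂ ℤ._+_ (≡.sym (ℤΣ.∑-δ (st<N w) (ℤΣ.𝟙 ∘ g))) (count-partition st st<N g ws) ⟩
  ℤΣ.∑ N (λ j → δ j ℤ.* ℤΣ.𝟙 (g j)) ℤ.+ ℤΣ.∑ N (λ j → ℤΣ.𝟙 (g j) ℤ.* C j)
    ≡⟨ ≡.sym (ℤΣ.∑-distrib-+ N _ _) ⟩
  ℤΣ.∑ N (λ j → δ j ℤ.* ℤΣ.𝟙 (g j) ℤ.+ ℤΣ.𝟙 (g j) ℤ.* C j)
    ≡⟨ ℤΣ.∑-cong N (λ j _ → ≡.trans (≡.cong (ℤ._+ ℤΣ.𝟙 (g j) ℤ.* C j) (ℤ.*-comm (δ j) _))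
                                    (≡.sym (ℤ.*-distribˡ-+ (ℤΣ.𝟙 (g j)) (δ j) (C j)))) ⟩
  ℤΣ.∑ N (λ j → ℤΣ.𝟙 (g j) ℤ.* (δ j ℤ.+ C j))
    ∎
  where
  open ≡.≡-Reasoning
  δ : ℕ → ℤ
  δ j = ℤΣ.𝟙 (does (st w ℕ.≟ j))
  C : ℕ → ℤ
  C j = count (λ w → does (st w ℕ.≟ j)) ws

record Automaton : Set where
  field
    size      : ℕ
    state     : Word → ℕ
    step      : ℕ → ℕ → ℕ
    threshold : ℕ
    state-<   : ∀ w → state w < size
    state-∷   : ∀ a w → state (a ∷ w) ≡ step a (state w)
    step-≥    : ∀ {a} j → threshold ≤ a → step a j ≡ step threshold j

module TransferMatrix (A : Automaton) where

  open Automaton A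

  counts : ℕ → Series
  counts j ℓ n = count (λ w → does (state w ℕ.≟ j)) (comps ℓ n)

  initial : ℕ → Series
  initial i = univariate (counts i 0)

  letters : ℕ → ℕ → ℕ → ℤ
  letters i j zero    = + 0
  letters i j (suc a) = ℤΣ.𝟙 (does (step (suc a) j ℕ.≟ i))

  transition : ℕ → ℕ → Series
  transition i j = t· letters i j

  counts-suc : ∀ i ℓ n → counts i (suc ℓ) n ≡
    ℤΣ.∑ size (λ j → ℤΣ.∑ n (λ a → letters i j (suc a) ℤ.* counts j ℓ (n ∸ suc a)))
  counts-suc i ℓ n = begin
    counts i (suc ℓ) n
      ≡⟨ count-comps-suc _ ℓ n ⟩
    ℤΣ.∑ n (λ a → count (λ w → does (state (suc a ∷ w) ℕ.≟ i)) (comps ℓ (n ∸ suc a)))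
      ≡⟨ ℤΣ.∑-cong n (λ a _ → count-cong (λ w → ≡.cong (λ s → does (s ℕ.≟ i)) (state-∷ (suc a) w))
                                          (comps ℓ (n ∸ suc a))) ⟩
    ℤΣ.∑ n (λ a → count (λ w → does (step (suc a) (state w) ℕ.≟ i)) (comps ℓ (n ∸ suc a)))
      ≡⟨ ℤΣ.∑-cong n (λ a _ → count-partition state state-< (λ j → does (step (suc a) j ℕ.≟ i))
                                               (comps ℓ (n ∸ suc a))) ⟩
    ℤΣ.∑ n (λ a → ℤΣ.∑ size (λ j → letters i j (suc a) ℤ.* counts j ℓ (n ∸ suc a)))
      ≡⟨ ℤΣ.∑-comm n size _ ⟩
    ℤΣ.∑ size (λ j → ℤΣ.∑ n (λ a → letters i j (suc a) ℤ.* counts j ℓ (n ∸ suc a)))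
      ∎
    where open ≡.≡-Reasoning

  counts-equation : ∀ i → counts i ≈ initial i + ∑ size (λ j → transition i j * counts j)
  counts-equation i = sym (coeff⇒≈ λ ℓ n →
    ≡.trans (+-coeff (initial i) _ ℓ n) (≡.trans (≡.cong (ℤ._+_ (initial i ℓ n)) (∑-coeff size _ ℓ n))
            (by-length ℓ n)))
    where
    open ≡.≡-Reasoning
    by-length : ∀ ℓ n →
      initial i ℓ n ℤ.+ ℤΣ.∑ size (λ j → (transition i j * counts j) ℓ n) ≡ counts i ℓ n
    by-length zero n = begin
      counts i 0 n ℤ.+ ℤΣ.∑ size (λ j → (transition i j * counts j) 0 n)
        ≡⟨ ≡.cong (ℤ._+_ (counts i 0 n))
                  (ℤΣ.∑-zero size (λ j _ → t·-*-coeff-zero (letters i j) (counts j) n)) ⟩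
      counts i 0 n ℤ.+ + 0
        ≡⟨ ℤ.+-identityʳ _ ⟩
      counts i 0 n ∎
    by-length (suc ℓ) n = begin
      + 0 ℤ.+ ℤΣ.∑ size (λ j → (transition i j * counts j) (suc ℓ) n)
        ≡⟨ ℤ.+-identityˡ _ ⟩
      ℤΣ.∑ size (λ j → (transition i j * counts j) (suc ℓ) n)
        ≡⟨ ℤΣ.∑-cong size (λ j _ → t·-*-coeff-suc (letters i j) (counts j) ℓ n) ⟩
      ℤΣ.∑ size (λ j → ℤΣ.∑ (suc n) (λ b → letters i j b ℤ.* counts j ℓ (n ∸ b)))
        ≡⟨ ℤΣ.∑-cong size (λ j _ → ≡.trans (ℤΣ.∑-suc n _) (ℤ.+-identityˡ _)) ⟩
      ℤΣ.∑ size (λ j → ℤΣ.∑ n (λ a → letters i j (suc a) ℤ.* counts j ℓ (n ∸ suc a)))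
        ≡⟨ ≡.sym (counts-suc i ℓ n) ⟩
      counts i (suc ℓ) n ∎

  poly-initial : ∀ i → IsPolynomial (initial i)
  poly-initial i = 0 , vanishes
    where
    vanishes : ∀ ℓ n → 0 < ℓ ⊎ 0 < n → initial i ℓ n ≡ + 0
    vanishes (suc ℓ) n       _ = ≡.refl
    vanishes zero    (suc n) _ = ≡.refl
    vanishes zero    zero    (inj₁ ())
    vanishes zero    zero    (inj₂ ())

  poly-1-x*transition : ∀ i j → IsPolynomial (1-x * transition i j)
  poly-1-x*transition i j = eventually-constant⇒poly-1-x* (suc threshold) high-t stable
    where
    high-t : ∀ ℓ n → suc threshold < ℓ → transition i j ℓ n ≡ + 0
    high-t (suc (suc ℓ)) n _ = ≡.refl
    high-t (suc zero)    n (s≤s ())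
    stable : ∀ ℓ n → suc threshold < n → transition i j ℓ (suc n) ≡ transition i j ℓ n
    stable zero          n _ = ≡.refl
    stable (suc (suc ℓ)) n _ = ≡.refl
    stable (suc zero) (suc (suc n)) (s≤s (s≤s threshold≤n)) =
      ≡.trans (≡.cong letter (step-≥ j (ℕ.m≤n⇒m≤1+n threshold≤2+n)))
              (≡.sym (≡.cong letter (step-≥ j threshold≤2+n)))
      where
      letter : ℕ → ℤ
      letter s = ℤΣ.𝟙 (does (s ℕ.≟ i))
      threshold≤2+n : threshold ≤ suc (suc n)
      threshold≤2+n = ℕ.m≤n⇒m≤1+n (ℕ.m≤n⇒m≤1+n threshold≤n)

  system : PolynomialSystem size counts
  system = record
    { scale       = 1-x
    ; const       = λ i → 1-x * initial i
    ; matrix      = λ i j → 1-x * transition i j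
    ; scale-poly  = poly-1-x
    ; scale-00    = 1-x-00
    ; const-poly  = λ i → poly-* poly-1-x (poly-initial i)
    ; matrix-poly = poly-1-x*transition
    ; matrix-00   = λ i j → ≡.trans (constant-term-* 1-x (transition i j)) (ℤ.*-zeroʳ (1-x 0 0))
    ; equation    = λ i _ → begin
        1-x * counts i
          ≈⟨ *-congˡ (counts-equation i) ⟩
        1-x * (initial i + ∑ size (λ j → transition i j * counts j))
          ≈⟨ trans (distribˡ _ _ _) (+-congˡ (*-distribˡ-∑ size _ _)) ⟩
        1-x * initial i + ∑ size (λ j → 1-x * (transition i j * counts j))
          ≈⟨ +-congˡ (∑-cong size (λ j _ → sym (*-assoc _ _ _))) ⟩
        1-x * initial i + ∑ size (λ j → (1-x * transition i j) * counts j)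
          ∎
    }
    where open ≈-Reasoning

  accepted : (ℕ → Bool) → Series
  accepted acc ℓ n = count (acc ∘ state) (comps ℓ n)

  fraction-accepted : ∀ acc → Fraction (accepted acc)
  fraction-accepted acc = fraction-resp-≈ (coeff⇒≈ by-final-state)
    (fraction-∑ size selected (λ j j<size → fraction-selected j (acc j) j<size))
    where
    selected : ℕ → Series
    selected j = if acc j then counts j else 0#

    fraction-selected : ∀ j b → j < size → Fraction (if b then counts j else 0#)
    fraction-selected j true  j<size = polynomialSystem⇒fraction system j j<size
    fraction-selected j false _      = fraction-0#

    selected-coeff : ∀ j b ℓ n → (if b then counts j else 0#) ℓ n ≡ ℤΣ.𝟙 b ℤ.* counts j ℓ n
    selected-coeff j true  ℓ n = ≡.sym (ℤ.*-identityˡ (counts j ℓ n))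
    selected-coeff j false ℓ n = 0#-coeff ℓ n

    by-final-state : ∀ ℓ n → ∑ size selected ℓ n ≡ accepted acc ℓ n
    by-final-state ℓ n = ≡.trans (∑-coeff size selected ℓ n) (≡.trans
      (ℤΣ.∑-cong size (λ j _ → selected-coeff j (acc j) ℓ n))
      (≡.sym (count-partition state state-< acc (comps ℓ n))))

weight : Bool → ℕ → ℕ
weight b k = if b then 2 ℕ.^ k else 0

encode : List Bool → ℕ
encode []       = 0
encode (b ∷ bs) = weight b (length bs) ℕ.+ encode bs

decode : ℕ → ℕ → List Bool
decode zero    n = []
decode (suc k) n = does (2 ℕ.^ k ℕ.≤? n) ∷ decode k (n ∸ weight (does (2 ℕ.^ k ℕ.≤? n)) k)

encode-< : ∀ bs → encode bs < 2 ℕ.^ length bs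
encode-< []           = s≤s z≤n
encode-< (true  ∷ bs) = ℕ.+-monoʳ-< (2 ℕ.^ length bs) (ℕ.<-≤-trans (encode-< bs) (ℕ.m≤m+n _ 0))
encode-< (false ∷ bs) = ℕ.<-≤-trans (encode-< bs) (ℕ.m≤m+n _ _)

decode-encode : ∀ bs → decode (length bs) (encode bs) ≡ bs
decode-encode (true ∷ bs)
  rewrite dec-true (2 ℕ.^ length bs ℕ.≤? 2 ℕ.^ length bs ℕ.+ encode bs) (ℕ.m≤m+n _ _)
        | ℕ.m+n∸m≡n (2 ℕ.^ length bs) (encode bs)
        = ≡.cong (true ∷_) (decode-encode bs)
decode-encode (false ∷ bs)
  rewrite dec-false (2 ℕ.^ length bs ℕ.≤? encode bs) (ℕ.<⇒≱ (encode-< bs))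
        = ≡.cong (false ∷_) (decode-encode bs)
decode-encode [] = ≡.refl

-- The embedding automaton of u

module Embeddings (u : Word) where

  tail-flags : Word → Word → List Bool
  tail-flags v w =
    concatMap (λ v′ → does (prefix? ℕ._≤?_ v′ w) ∷ does (length w ℕ.≟ length v′) ∷ []) (tails v)

  step-tail-flags : Word → ℕ → List Bool → List Bool
  step-tail-flags []      a _                   = true ∷ false ∷ []
  step-tail-flags (x ∷ v) a (_ ∷ _ ∷ p ∷ l ∷ fs) =
    (does (x ℕ.≤? a) ∧ p) ∷ l ∷ step-tail-flags v a (p ∷ l ∷ fs)
  step-tail-flags (x ∷ v) a _                   = []

  step-tail-flags-∷ : ∀ v a w → step-tail-flags v a (tail-flags v w) ≡ tail-flags v (a ∷ w)
  step-tail-flags-∷ []      a w = ≡.refl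
  step-tail-flags-∷ (x ∷ v) a w = ≡.cong (λ fs → _ ∷ _ ∷ fs) (step-tail-flags-∷ v a w)

  step-tail-flags-≥ : ∀ {a b} v fs → All (_≤ a) v → All (_≤ b) v →
                      step-tail-flags v a fs ≡ step-tail-flags v b fs
  step-tail-flags-≥ []      fs _ _ = ≡.refl
  step-tail-flags-≥ {a} {b} (x ∷ v) (_ ∷ _ ∷ p ∷ l ∷ fs) (x≤a ∷ v≤a) (x≤b ∷ v≤b)
    rewrite dec-true (x ℕ.≤? a) x≤a | dec-true (x ℕ.≤? b) x≤b
    = ≡.cong (λ fs → _ ∷ _ ∷ fs) (step-tail-flags-≥ v (p ∷ l ∷ fs) v≤a v≤b)
  step-tail-flags-≥ (x ∷ v) []                   _ _ = ≡.refl
  step-tail-flags-≥ (x ∷ v) (_ ∷ [])             _ _ = ≡.refl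
  step-tail-flags-≥ (x ∷ v) (_ ∷ _ ∷ [])         _ _ = ≡.refl
  step-tail-flags-≥ (x ∷ v) (_ ∷ _ ∷ _ ∷ [])     _ _ = ≡.refl

  length-tail-flags : ∀ v w → length (tail-flags v w) ≡ length (tail-flags v [])
  length-tail-flags []      w = ≡.refl
  length-tail-flags (x ∷ v) w = ≡.cong (suc ∘ suc) (length-tail-flags v w)

  bits : Word → List Bool
  bits w = does (InF? u w)
         ∷ does (all? (λ s → prefix? ℕ._≤?_ u s →-dec (length s ℕ.≟ length u)) (tails w))
         ∷ tail-flags u w

  extend : Bool → Bool → List Bool → List Bool
  extend e s (p ∷ l ∷ fs) = (p ∨ e) ∷ ((not p ∨ l) ∧ s) ∷ p ∷ l ∷ fs
  extend e s _            = []

  step-bits : ℕ → List Bool → List Bool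
  step-bits a (e ∷ s ∷ fs) = extend e s (step-tail-flags u a fs)
  step-bits a _            = []

  step-bits-∷ : ∀ a w → step-bits a (bits w) ≡ bits (a ∷ w)
  step-bits-∷ a w rewrite step-tail-flags-∷ u a w = ≡.refl

  step-bits-≥ : ∀ {a} bs → max 0 u ≤ a → step-bits a bs ≡ step-bits (max 0 u) bs
  step-bits-≥ (e ∷ s ∷ fs) u≤a =
    ≡.cong (extend e s)
           (step-tail-flags-≥ u fs (All.map (λ x≤ → ℕ.≤-trans x≤ u≤a) (xs≤max 0 u)) (xs≤max 0 u))
  step-bits-≥ []           _ = ≡.refl
  step-bits-≥ (_ ∷ [])     _ = ≡.refl

  width : ℕ
  width = length (bits [])

  decode-encode-bits : ∀ w → decode width (encode (bits w)) ≡ bits w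
  decode-encode-bits w = ≡.subst (λ k → decode k (encode (bits w)) ≡ bits w)
    (≡.cong (suc ∘ suc) (length-tail-flags u w)) (decode-encode (bits w))

  automaton : Automaton
  automaton = record
    { size      = 2 ℕ.^ width
    ; state     = encode ∘ bits
    ; step      = λ a j → encode (step-bits a (decode width j))
    ; threshold = max 0 u
    ; state-<   = λ w → ≡.subst (λ k → encode (bits w) < 2 ℕ.^ k)
                          (≡.cong (suc ∘ suc) (length-tail-flags u w)) (encode-< (bits w))
    ; state-∷   = λ a w → ≡.cong encode (≡.trans (≡.sym (step-bits-∷ a w))
                                                  (≡.cong (step-bits a) (≡.sym (decode-encode-bits w))))
    ; step-≥    = λ j u≤a → ≡.cong encode (step-bits-≥ (decode width j) u≤a)
    }

  open TransferMatrix automaton using (accepted; fraction-accepted)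

  bits-determined⇒isRational : ∀ {P : Word → Set} (P? : ∀ w → Dec (P w))
    (accept : List Bool → Bool) → (∀ w → does (P? w) ≡ accept (bits w)) → IsRational (coeff P?)
  bits-determined⇒isRational P? accept P?≡accept = fraction⇒isRational
    (fraction-resp-≈ (coeff⇒≈ accepted≡coeff) (fraction-accepted (accept ∘ decode width)))
    where
    accepted≡coeff : ∀ ℓ n → accepted (accept ∘ decode width) ℓ n ≡ coeff P? ℓ n
    accepted≡coeff ℓ n = ≡.sym (≡.trans (length-filter≡count P? (comps ℓ n))
      (count-cong (λ w → ≡.trans (P?≡accept w) (≡.cong accept (≡.sym (decode-encode-bits w))))
                  (comps ℓ n)))

-- The deciders InF?, InS? and InA? compute
-- exactly the leading bits of `bits`, hence the reflexivity proofs.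
theorem3p2 : (u : Word) → Positive u →
    IsRational (Fgf u) × IsRational (Sgf u) × IsRational (Agf u)
theorem3p2 u _ =
  bits-determined⇒isRational (InF? u) first (λ _ → ≡.refl) ,
  bits-determined⇒isRational (InS? u) (λ bs → first bs ∧ second bs) (λ _ → ≡.refl) ,
  bits-determined⇒isRational (InA? u) (not ∘ first) (λ _ → ≡.refl)
  where
  open Embeddings u
  first second : List Bool → Bool
  first (b ∷ _) = b
  first []      = false
  second (_ ∷ b ∷ _) = b
  second _           = false
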